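{- Let $\mathcal{C}=\{C_1,\dots,C_k\}$ be a set of vertex-disjoint cycles (in a complete graph) and let $f\in E(\mathcal{C})$. Then the edge set $E(\mathcal{C})\setminus \{f\}$ can be odd-covered using 2 paths.
   Context: Graphs are simple; cycles have at least three vertices. $E(\mathcal C)=\bigcup_i E(C_i)$. A set $F$ of edges of a complete graph is odd-covered by paths $P_1,\dots,P_m$ of that complete graph if $E(P_1)\oplus\cdots\oplus E(P_m)=F$, where $\oplus$ denotes symmetric difference. -}

module Defs where

open import Data.Nat using (ℕ; _≤_)
open import Data.Fin using (Fin; _≟_)
open import Data.Bool using (Bool; true; false; _∧_; _∨_; not)
open import Data.List using (List; []; _∷_; _++_; [_]; length; concat)
open import Data.Bool.ListAction using (any)
open import Data.List.Relation.Unary.Unique.Propositional using (Unique)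
open import Data.List.Relation.Unary.All using (All)
open import Data.Product using (_×_)
open import Relation.Nullary.Decidable using (⌊_⌋)

-- Vertices of the complete graph K_n are Fin n; every pair of distinct
-- vertices is an edge.  An edge set is represented by its characteristic
-- function on (ordered) pairs of vertices, read symmetrically.

sameEdge : ∀ {n} → Fin n → Fin n → Fin n → Fin n → Bool
sameEdge a b u v = (⌊ a ≟ u ⌋ ∧ ⌊ b ≟ v ⌋) ∨ (⌊ a ≟ v ⌋ ∧ ⌊ b ≟ u ⌋)

walkEdge : ∀ {n} → List (Fin n) → Fin n → Fin n → Bool
walkEdge [] u v = false
walkEdge (a ∷ []) u v = false
walkEdge (a ∷ b ∷ xs) u v = sameEdge a b u v ∨ walkEdge (b ∷ xs) u v

IsPath : ∀ {n} → List (Fin n) → Set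
IsPath p = Unique p × (1 ≤ length p)

pathEdge : ∀ {n} → List (Fin n) → Fin n → Fin n → Bool
pathEdge = walkEdge

IsCycle : ∀ {n} → List (Fin n) → Set
IsCycle c = Unique c × (3 ≤ length c)

cycleEdge : ∀ {n} → List (Fin n) → Fin n → Fin n → Bool
cycleEdge [] u v = false
cycleEdge (a ∷ xs) u v = walkEdge ((a ∷ xs) ++ [ a ]) u v

-- A family of vertex-disjoint cycles: each is a cycle and no vertex occurs
-- in two of them (equivalently, together with distinctness inside each
-- cycle, the concatenation of all vertex lists has no repetition).
VertexDisjointCycles : ∀ {n} → List (List (Fin n)) → Set
VertexDisjointCycles cs = All IsCycle cs × Unique (concat cs)

cyclesEdge : ∀ {n} → List (List (Fin n)) → Fin n → Fin n → Bool
cyclesEdge cs u v = any (λ c → cycleEdge c u v) cs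

_xor_ : Bool → Bool → Bool
true xor b = not b
false xor b = b

-- Cut each cycle x y … at its edge {x, y}, leaving the path y … x.  P₁ runs
-- through these paths one after another and P₂ visits only their end points
-- y x y′ x′ …: every connecting edge x y′ lies on both paths and cancels, and
-- P₂ contributes the cut edges {x, y}.  Rotating the cycle containing f so
-- that f becomes its cut edge and putting it first, P₂ may start at x, which
-- drops f.  Symmetric differences are computed with walkEdge⊕, the mod-2 edge
-- count of a walk: it agrees with walkEdge on paths and is additive under
-- concatenation.
module Submission where

open import Defs
open import Level using (Level)
open import Data.Nat using (ℕ; _≤_; s≤s; z≤n)
open import Data.Fin using (Fin; _≟_)
open import Data.Bool using (Bool; true; false; _∧_; _∨_; not) renaming (_xor_ to _⊕_)
open import Data.Bool.Properties
  using (∨-comm; ∨-assoc; ∨-identityʳ; ∧-comm; ∧-identityʳ; ∨-commutativeMonoid;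
         xor-assoc; xor-same; xor-identityʳ; xor-∧-commutativeRing)
open import Data.Bool.ListAction using (any)
open import Data.List using (List; []; _∷_; _++_; [_]; concat; concatMap)
open import Data.List.Properties using (++-assoc; ++-identityʳ)
open import Data.List.Membership.Propositional using (_∈_; _∉_)
open import Data.List.Membership.Propositional.Properties using (∈-++⁺ˡ; ∈-++⁺ʳ; ∈-++⁻)
open import Data.List.Relation.Unary.All using (_∷_)
open import Data.List.Relation.Unary.Any using (here; there)
open import Data.List.Relation.Unary.AllPairs using ([]; _∷_)
open import Data.List.Relation.Unary.Unique.Propositional using (Unique)
open import Data.List.Relation.Unary.Unique.Propositional.Properties using (Unique[x∷xs]⇒x∉xs)
open import Data.List.Relation.Binary.Disjoint.Propositional using (Disjoint)
open import Data.List.Relation.Binary.Permutation.Propositional as Perm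
  using (_↭_; ↭-refl; ↭-prep; ↭-swap; ↭-sym; ↭-trans; ↭-reflexive; ↭⇒↭ₛ)
import Data.List.Relation.Binary.Permutation.Propositional.Properties as ↭
import Data.List.Relation.Binary.Permutation.Setoid.Properties as ↭ₛ
open import Data.List.Relation.Binary.Sublist.Propositional using (_⊆_; []; _∷_; _∷ʳ_; ⊆-refl)
import Data.List.Relation.Binary.Sublist.Propositional.Properties as ⊆
open import Data.Product as Product using (∃; ∃₂; _×_; _,_; proj₁)
open import Data.Sum using (_⊎_; inj₁; inj₂; [_,_]′)
open import Function using (_∘_)
open import Data.Empty using (⊥; ⊥-elim)
open import Algebra.Bundles using (CommutativeMonoid; CommutativeRing)
import Algebra.Properties.CommutativeSemigroup as CommutativeSemigroupProperties
open import Relation.Nullary using (yes; no)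
open import Relation.Nullary.Decidable using (⌊_⌋)
open import Relation.Binary.PropositionalEquality
  using (_≡_; refl; sym; trans; cong; cong₂; subst; setoid; module ≡-Reasoning)

open CommutativeSemigroupProperties (CommutativeMonoid.commutativeSemigroup ∨-commutativeMonoid)
  using () renaming (x∙yz≈y∙xz to ∨-left-comm)
open CommutativeSemigroupProperties (CommutativeRing.+-commutativeSemigroup xor-∧-commutativeRing)
  using () renaming (interchange to ⊕-interchange)
open ≡-Reasoning

private
  variable
    a : Level
    A : Set a
    n : ℕ
    x y : A
    xs ys zs : List A

∨-split : ∀ p {q} → p ∨ q ≡ true → p ≡ true ⊎ q ≡ true
∨-split true  _ = inj₁ refl
∨-split false e = inj₂ e

xor≡⊕ : ∀ p q → p xor q ≡ p ⊕ q
xor≡⊕ true  _ = refl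
xor≡⊕ false _ = refl

∨≡⊕ : ∀ p q → (p ≡ true → q ≡ true → ⊥) → p ∨ q ≡ p ⊕ q
∨≡⊕ true  true  disjoint = ⊥-elim (disjoint refl refl)
∨≡⊕ true  false _        = refl
∨≡⊕ false _     _        = refl

⊕-cancel-common : ∀ s p q p′ q′ → (s ⊕ (p ⊕ q)) ⊕ (s ⊕ (p′ ⊕ q′)) ≡ (p ⊕ p′) ⊕ (q ⊕ q′)
⊕-cancel-common s p q p′ q′ = begin
  (s ⊕ (p ⊕ q)) ⊕ (s ⊕ (p′ ⊕ q′))  ≡⟨ ⊕-interchange s (p ⊕ q) s (p′ ⊕ q′) ⟩
  (s ⊕ s) ⊕ ((p ⊕ q) ⊕ (p′ ⊕ q′))  ≡⟨ cong (_⊕ _) (xor-same s) ⟩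
  (p ⊕ q) ⊕ (p′ ⊕ q′)              ≡⟨ ⊕-interchange p q p′ q′ ⟩
  (p ⊕ p′) ⊕ (q ⊕ q′)              ∎

⊕-∧-not : ∀ w f r → (f ≡ true → w ≡ true → ⊥) → (f ≡ true → r ≡ true → ⊥) →
          ((w ⊕ f) ⊕ r) ∧ not f ≡ w ⊕ r
⊕-∧-not w     false r     _  _  = trans (∧-identityʳ _) (cong (_⊕ r) (xor-identityʳ w))
⊕-∧-not true  true  _     fw _  = ⊥-elim (fw refl refl)
⊕-∧-not false true  true  _  fr = ⊥-elim (fr refl refl)
⊕-∧-not false true  false _  _  = refl

any-resp-↭ : ∀ (p : A → Bool) → xs ↭ ys → any p xs ≡ any p ys
any-resp-↭ p Perm.refl          = refl
any-resp-↭ p (Perm.prep x q)    = cong (p x ∨_) (any-resp-↭ p q)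
any-resp-↭ p (Perm.swap x y q)  =
  trans (∨-left-comm (p x) (p y) _) (cong (λ r → p y ∨ (p x ∨ r)) (any-resp-↭ p q))
any-resp-↭ p (Perm.trans q q′)  = trans (any-resp-↭ p q) (any-resp-↭ p q′)

any⇒↭∷ : ∀ (p : A → Bool) xs → any p xs ≡ true → ∃₂ λ y ys → xs ↭ y ∷ ys × p y ≡ true
any⇒↭∷ p (x ∷ xs) e with ∨-split (p x) e
... | inj₁ px = x , xs , ↭-refl , px
... | inj₂ e′ with any⇒↭∷ p xs e′
...   | y , ys , xs↭ , py = y , x ∷ ys , ↭-trans (↭-prep x xs↭) (↭-swap x y ↭-refl) , py

concat⁺ : ∀ {xss yss : List (List A)} → xss ↭ yss → concat xss ↭ concat yss
concat⁺ Perm.refl            = ↭-refl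
concat⁺ (Perm.prep xs p)     = ↭.++⁺ˡ xs (concat⁺ p)
concat⁺ (Perm.swap xs ys p)  = ↭-trans (↭.shifts xs ys) (↭.++⁺ˡ ys (↭.++⁺ˡ xs (concat⁺ p)))
concat⁺ (Perm.trans p q)     = ↭-trans (concat⁺ p) (concat⁺ q)

Unique-resp-↭ : xs ↭ ys → Unique xs → Unique ys
Unique-resp-↭ p = ↭ₛ.Unique-resp-↭ (setoid _) (↭⇒↭ₛ p)

Unique-resp-⊇ : xs ⊆ ys → Unique ys → Unique xs
Unique-resp-⊇ []            _          = []
Unique-resp-⊇ (y ∷ʳ p)      (_ ∷ u)    = Unique-resp-⊇ p u
Unique-resp-⊇ (refl ∷ p)    (y∉ ∷ u)   = ⊆.All-resp-⊆ p y∉ ∷ Unique-resp-⊇ p u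

Unique-++ʳ : ∀ xs → Unique (xs ++ ys) → Unique ys
Unique-++ʳ xs = Unique-resp-⊇ (⊆.++⁺ˡ xs ⊆-refl)

Unique-++⇒Disjoint : ∀ xs → Unique (xs ++ ys) → Disjoint xs ys
Unique-++⇒Disjoint (x ∷ xs) u@(_ ∷ _) (here refl , v∈ys) = Unique[x∷xs]⇒x∉xs u (∈-++⁺ʳ xs v∈ys)
Unique-++⇒Disjoint (x ∷ xs) (_ ∷ u) (there v∈xs , v∈ys) = Unique-++⇒Disjoint xs u (v∈xs , v∈ys)

sameEdge-sound : ∀ (a b u v : Fin n) → sameEdge a b u v ≡ true → (a ≡ u × b ≡ v) ⊎ (a ≡ v × b ≡ u)
sameEdge-sound a b u v e with a ≟ u | b ≟ v | a ≟ v | b ≟ u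
... | yes a≡u | yes b≡v | _       | _       = inj₁ (a≡u , b≡v)
... | _       | _       | yes a≡v | yes b≡u = inj₂ (a≡v , b≡u)
sameEdge-sound _ _ _ _ () | no _  | _     | no _  | _
sameEdge-sound _ _ _ _ () | no _  | _     | yes _ | no _
sameEdge-sound _ _ _ _ () | yes _ | no _  | no _  | _
sameEdge-sound _ _ _ _ () | yes _ | no _  | yes _ | no _

sameEdge-endpoints : ∀ (a b u v : Fin n) {xs} → sameEdge a b u v ≡ true → u ∈ a ∷ b ∷ xs × v ∈ a ∷ b ∷ xs
sameEdge-endpoints a b u v e with sameEdge-sound a b u v e
... | inj₁ (refl , refl) = here refl , there (here refl)
... | inj₂ (refl , refl) = there (here refl) , here refl

sameEdge-sym : ∀ (a b u v : Fin n) → sameEdge a b u v ≡ sameEdge a b v u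
sameEdge-sym a b u v = ∨-comm (⌊ a ≟ u ⌋ ∧ ⌊ b ≟ v ⌋) (⌊ a ≟ v ⌋ ∧ ⌊ b ≟ u ⌋)

sameEdge-comm : ∀ (a b u v : Fin n) → sameEdge a b u v ≡ sameEdge b a u v
sameEdge-comm a b u v = trans (∨-comm (⌊ a ≟ u ⌋ ∧ ⌊ b ≟ v ⌋) (⌊ a ≟ v ⌋ ∧ ⌊ b ≟ u ⌋))
  (cong₂ _∨_ (∧-comm ⌊ a ≟ v ⌋ ⌊ b ≟ u ⌋) (∧-comm ⌊ a ≟ u ⌋ ⌊ b ≟ v ⌋))

sameEdge-subst : ∀ {p q a b : Fin n} → sameEdge p q a b ≡ true →
                 ∀ u v → sameEdge a b u v ≡ sameEdge p q u v
sameEdge-subst {p = p} {q} {a} {b} e u v with sameEdge-sound p q a b e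
... | inj₁ (refl , refl) = refl
... | inj₂ (refl , refl) = sameEdge-comm a b u v

walkEdge⊕ : List (Fin n) → Fin n → Fin n → Bool
walkEdge⊕ (a ∷ b ∷ xs) u v = sameEdge a b u v ⊕ walkEdge⊕ (b ∷ xs) u v
walkEdge⊕ _            _ _ = false

walkEdge-++ : ∀ (xs : List (Fin n)) y ys u v →
              walkEdge (xs ++ y ∷ ys) u v ≡ walkEdge (xs ++ [ y ]) u v ∨ walkEdge (y ∷ ys) u v
walkEdge-++ []            y ys u v = refl
walkEdge-++ (x ∷ [])      y ys u v = cong (_∨ walkEdge (y ∷ ys) u v) (sym (∨-identityʳ (sameEdge x y u v)))
walkEdge-++ (x ∷ x′ ∷ xs) y ys u v =
  trans (cong (sameEdge x x′ u v ∨_) (walkEdge-++ (x′ ∷ xs) y ys u v))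
        (sym (∨-assoc (sameEdge x x′ u v) (walkEdge (x′ ∷ xs ++ [ y ]) u v) (walkEdge (y ∷ ys) u v)))

walkEdge⊕-++ : ∀ (xs : List (Fin n)) y ys u v →
               walkEdge⊕ (xs ++ y ∷ ys) u v ≡ walkEdge⊕ (xs ++ [ y ]) u v ⊕ walkEdge⊕ (y ∷ ys) u v
walkEdge⊕-++ []            y ys u v = refl
walkEdge⊕-++ (x ∷ [])      y ys u v = cong (_⊕ walkEdge⊕ (y ∷ ys) u v) (sym (xor-identityʳ (sameEdge x y u v)))
walkEdge⊕-++ (x ∷ x′ ∷ xs) y ys u v =
  trans (cong (sameEdge x x′ u v ⊕_) (walkEdge⊕-++ (x′ ∷ xs) y ys u v))
        (sym (xor-assoc (sameEdge x x′ u v) (walkEdge⊕ (x′ ∷ xs ++ [ y ]) u v) (walkEdge⊕ (y ∷ ys) u v)))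

walkEdge-sym : ∀ (xs : List (Fin n)) u v → walkEdge xs u v ≡ walkEdge xs v u
walkEdge-sym []           u v = refl
walkEdge-sym (a ∷ [])     u v = refl
walkEdge-sym (a ∷ b ∷ xs) u v = cong₂ _∨_ (sameEdge-sym a b u v) (walkEdge-sym (b ∷ xs) u v)

walkEdge-endpoints : ∀ (xs : List (Fin n)) {u v} → walkEdge xs u v ≡ true → u ∈ xs × v ∈ xs
walkEdge-endpoints (a ∷ b ∷ xs) {u} {v} e =
  [ sameEdge-endpoints a b u v , Product.map there there ∘ walkEdge-endpoints (b ∷ xs) ]′
    (∨-split (sameEdge a b u v) e)

walkEdge-split : ∀ (zs : List (Fin n)) {a b} → walkEdge zs a b ≡ true →
                 ∃₂ λ pre post → ∃₂ λ p q → zs ≡ pre ++ p ∷ q ∷ post × sameEdge p q a b ≡ true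
walkEdge-split (x ∷ y ∷ zs) {a} {b} e =
  [ (λ xy → [] , zs , x , y , refl , xy) , extend ∘ walkEdge-split (y ∷ zs) ]′
    (∨-split (sameEdge x y a b) e)
  where
  extend : ∀ {ys} → ∃₂ (λ pre post → ∃₂ λ p q → ys ≡ pre ++ p ∷ q ∷ post × sameEdge p q a b ≡ true) →
           ∃₂ (λ pre post → ∃₂ λ p q → x ∷ ys ≡ pre ++ p ∷ q ∷ post × sameEdge p q a b ≡ true)
  extend (pre , post , p , q , split , pq) = x ∷ pre , post , p , q , cong (x ∷_) split , pq

walkEdge-from-head : ∀ {y z : Fin n} {zs v} → y ∉ z ∷ zs → walkEdge (y ∷ z ∷ zs) y v ≡ true → v ≡ z
walkEdge-from-head {y = y} {z} {v = v} y∉ e with ∨-split (sameEdge y z y v) e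
... | inj₂ e′ = ⊥-elim (y∉ (proj₁ (walkEdge-endpoints _ e′)))
... | inj₁ yz with sameEdge-sound y z y v yz
...   | inj₁ (_ , z≡v)    = sym z≡v
...   | inj₂ (y≡v , z≡y) = sym (trans z≡y y≡v)

walkEdge≡walkEdge⊕ : ∀ {xs : List (Fin n)} → Unique xs → ∀ u v → walkEdge xs u v ≡ walkEdge⊕ xs u v
walkEdge≡walkEdge⊕ {xs = []}         _  u v = refl
walkEdge≡walkEdge⊕ {xs = _ ∷ []}     _  u v = refl
walkEdge≡walkEdge⊕ {xs = x ∷ y ∷ xs} uq@(_ ∷ uq′) u v =
  trans (∨≡⊕ (sameEdge x y u v) (walkEdge (y ∷ xs) u v) edge-not-in-tail)
        (cong (sameEdge x y u v ⊕_) (walkEdge≡walkEdge⊕ uq′ u v))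
  where
  edge-not-in-tail : sameEdge x y u v ≡ true → walkEdge (y ∷ xs) u v ≡ true → ⊥
  edge-not-in-tail xy e with sameEdge-sound x y u v xy | walkEdge-endpoints (y ∷ xs) e
  ... | inj₁ (refl , _) | u∈ , _ = Unique[x∷xs]⇒x∉xs uq u∈
  ... | inj₂ (refl , _) | _ , v∈ = Unique[x∷xs]⇒x∉xs uq v∈

cycleEdge-rotate₁ : ∀ (x : Fin n) xs u v → cycleEdge (x ∷ xs) u v ≡ cycleEdge (xs ++ [ x ]) u v
cycleEdge-rotate₁ x []       u v = refl
cycleEdge-rotate₁ x (y ∷ ys) u v = begin
  sameEdge x y u v ∨ walkEdge (y ∷ ys ++ [ x ]) u v
    ≡⟨ ∨-comm (sameEdge x y u v) (walkEdge (y ∷ ys ++ [ x ]) u v) ⟩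
  walkEdge (y ∷ ys ++ [ x ]) u v ∨ sameEdge x y u v
    ≡⟨ cong (walkEdge (y ∷ ys ++ [ x ]) u v ∨_) (sym (∨-identityʳ (sameEdge x y u v))) ⟩
  walkEdge ((y ∷ ys) ++ [ x ]) u v ∨ walkEdge (x ∷ [ y ]) u v
    ≡⟨ walkEdge-++ (y ∷ ys) x [ y ] u v ⟨
  walkEdge ((y ∷ ys) ++ x ∷ [ y ]) u v
    ≡⟨ cong (λ l → walkEdge l u v) (++-assoc (y ∷ ys) [ x ] [ y ]) ⟨
  walkEdge (((y ∷ ys) ++ [ x ]) ++ [ y ]) u v
    ∎

cycleEdge-rotate : ∀ (xs ys : List (Fin n)) u v → cycleEdge (xs ++ ys) u v ≡ cycleEdge (ys ++ xs) u v
cycleEdge-rotate []       ys u v = cong (λ l → cycleEdge l u v) (sym (++-identityʳ ys))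
cycleEdge-rotate (x ∷ xs) ys u v = begin
  cycleEdge (x ∷ xs ++ ys) u v        ≡⟨ cycleEdge-rotate₁ x (xs ++ ys) u v ⟩
  cycleEdge ((xs ++ ys) ++ [ x ]) u v ≡⟨ cong (λ l → cycleEdge l u v) (++-assoc xs ys [ x ]) ⟩
  cycleEdge (xs ++ ys ++ [ x ]) u v   ≡⟨ cycleEdge-rotate xs (ys ++ [ x ]) u v ⟩
  cycleEdge ((ys ++ [ x ]) ++ xs) u v ≡⟨ cong (λ l → cycleEdge l u v) (++-assoc ys [ x ] xs) ⟩
  cycleEdge (ys ++ x ∷ xs) u v        ∎

cycleEdge-endpoint : ∀ (c : List (Fin n)) {u v} → cycleEdge c u v ≡ true → u ∈ c
cycleEdge-endpoint (x ∷ xs) e with ∈-++⁻ (x ∷ xs) (proj₁ (walkEdge-endpoints (x ∷ xs ++ [ x ]) e))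
... | inj₁ u∈c        = u∈c
... | inj₂ (here u≡x) = here u≡x

cyclesEdge-endpoint : ∀ (cs : List (List (Fin n))) {u v} → cyclesEdge cs u v ≡ true → u ∈ concat cs
cyclesEdge-endpoint (c ∷ cs) {u} {v} e with ∨-split (cycleEdge c u v) e
... | inj₁ e′ = ∈-++⁺ˡ (cycleEdge-endpoint c e′)
... | inj₂ e′ = ∈-++⁺ʳ c (cyclesEdge-endpoint cs e′)

cycleEdge-disjoint : ∀ (c : List (Fin n)) cs u v → Unique (c ++ concat cs) →
                     cycleEdge c u v ≡ true → cyclesEdge cs u v ≡ true → ⊥
cycleEdge-disjoint c cs u v uq e e′ =
  Unique-++⇒Disjoint c uq (cycleEdge-endpoint c e , cyclesEdge-endpoint cs e′)

IsCycle-resp-↭ : ∀ {c c′ : List (Fin n)} → c ↭ c′ → IsCycle c → IsCycle c′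
IsCycle-resp-↭ p (uq , len) = Unique-resp-↭ p uq , subst (3 ≤_) (↭.↭-length p) len

VertexDisjointCycles-resp-↭ : ∀ {cs ds : List (List (Fin n))} → cs ↭ ds →
                              VertexDisjointCycles cs → VertexDisjointCycles ds
VertexDisjointCycles-resp-↭ p (cycs , uq) = ↭.All-resp-↭ p cycs , Unique-resp-↭ (concat⁺ p) uq

VertexDisjointCycles-head-↭ : ∀ {c c′ : List (Fin n)} {cs} → c ↭ c′ →
                              VertexDisjointCycles (c ∷ cs) → VertexDisjointCycles (c′ ∷ cs)
VertexDisjointCycles-head-↭ p (cyc ∷ cycs , uq) = IsCycle-resp-↭ p cyc ∷ cycs , Unique-resp-↭ (↭.++⁺ʳ _ p) uq

rotateToEdge : ∀ {c : List (Fin n)} {a b} → IsCycle c → cycleEdge c a b ≡ true →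
               ∃₂ λ x y → ∃ λ zs → x ∷ y ∷ zs ↭ c ×
                 (∀ u v → cycleEdge (x ∷ y ∷ zs) u v ≡ cycleEdge c u v) × sameEdge x y a b ≡ true
rotateToEdge {c = []}         (_ , ())
rotateToEdge {c = _ ∷ []}     (_ , s≤s ())
rotateToEdge {c = x ∷ y ∷ zs} {a} {b} _ e with ∨-split (sameEdge x y a b) e
... | inj₁ xy = x , y , zs , ↭-refl , (λ _ _ → refl) , xy
... | inj₂ e′ with walkEdge-split (y ∷ zs ++ [ x ]) e′
...   | pre , post , p , q , split , pq = p , q , post ++ pre , perm , edges , pq
  where
  perm : p ∷ q ∷ post ++ pre ↭ x ∷ y ∷ zs
  perm = ↭-trans (↭.++-comm (p ∷ q ∷ post) pre)
           (↭-trans (↭-reflexive (sym split)) (↭-sym (↭.∷↭∷ʳ x (y ∷ zs))))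
  edges : ∀ u v → cycleEdge (p ∷ q ∷ post ++ pre) u v ≡ cycleEdge (x ∷ y ∷ zs) u v
  edges u v = begin
    cycleEdge ((p ∷ q ∷ post) ++ pre) u v ≡⟨ cycleEdge-rotate (p ∷ q ∷ post) pre u v ⟩
    cycleEdge (pre ++ p ∷ q ∷ post) u v   ≡⟨ cong (λ l → cycleEdge l u v) split ⟨
    cycleEdge (y ∷ zs ++ [ x ]) u v       ≡⟨ cycleEdge-rotate₁ x (y ∷ zs) u v ⟨
    cycleEdge (x ∷ y ∷ zs) u v            ∎

cut : List A → List A
cut []       = []
cut (x ∷ xs) = xs ++ [ x ]

cutEnds : List A → List A
cutEnds (x ∷ y ∷ _) = y ∷ x ∷ []
cutEnds xs          = xs

cut-↭ : ∀ (xs : List A) → cut xs ↭ xs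
cut-↭ []       = ↭-refl
cut-↭ (x ∷ xs) = ↭-sym (↭.∷↭∷ʳ x xs)

cut-unique : Unique xs → Unique (cut xs)
cut-unique {xs = xs} = Unique-resp-↭ (↭-sym (cut-↭ xs))

concatMap-cut-↭ : ∀ (xss : List (List A)) → concatMap cut xss ↭ concat xss
concatMap-cut-↭ []         = ↭-refl
concatMap-cut-↭ (xs ∷ xss) = ↭.++⁺ (cut-↭ xs) (concatMap-cut-↭ xss)

cutEnds⊆cut : ∀ (xs : List A) → cutEnds xs ⊆ cut xs
cutEnds⊆cut []           = ⊆-refl
cutEnds⊆cut (x ∷ [])     = ⊆-refl
cutEnds⊆cut (x ∷ y ∷ zs) = refl ∷ ⊆.++⁺ˡ zs ⊆-refl

concatMap-cutEnds⊆cut : ∀ (xss : List (List A)) → concatMap cutEnds xss ⊆ concatMap cut xss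
concatMap-cutEnds⊆cut []         = ⊆-refl
concatMap-cutEnds⊆cut (xs ∷ xss) = ⊆.++⁺ (cutEnds⊆cut xs) (concatMap-cutEnds⊆cut xss)

cut-avoids-cutEdge : ∀ {x y : Fin n} {zs u v} → IsCycle (x ∷ y ∷ zs) →
                     sameEdge x y u v ≡ true → walkEdge (y ∷ zs ++ [ x ]) u v ≡ true → ⊥
cut-avoids-cutEdge {zs = []} (_ , s≤s (s≤s ()))
cut-avoids-cutEdge {x = x} {y} {z ∷ zs} {u} {v} (uq , _) xy e =
  Unique[x∷xs]⇒x∉xs uq (there (here (walkEdge-from-head y∉ (yx-on-cut (sameEdge-sound x y u v xy)))))
  where
  C = y ∷ z ∷ zs ++ [ x ]
  y∉ : y ∉ z ∷ zs ++ [ x ]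
  y∉ = Unique[x∷xs]⇒x∉xs (cut-unique uq)
  yx-on-cut : (x ≡ u × y ≡ v) ⊎ (x ≡ v × y ≡ u) → walkEdge C y x ≡ true
  yx-on-cut (inj₁ (x≡u , y≡v)) = trans (cong₂ (walkEdge C) y≡v x≡u) (trans (walkEdge-sym C v u) e)
  yx-on-cut (inj₂ (x≡v , y≡u)) = trans (cong₂ (walkEdge C) y≡u x≡v) e

cycleEdge-cut : ∀ {x y : Fin n} {zs} → IsCycle (x ∷ y ∷ zs) → ∀ u v →
                cycleEdge (x ∷ y ∷ zs) u v ≡ walkEdge⊕ (y ∷ zs ++ [ x ]) u v ⊕ sameEdge x y u v
cycleEdge-cut {x = x} {y} {zs} cyc@(uq , _) u v = begin
  sameEdge x y u v ∨ walkEdge (y ∷ zs ++ [ x ]) u v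
    ≡⟨ ∨-comm (sameEdge x y u v) (walkEdge (y ∷ zs ++ [ x ]) u v) ⟩
  walkEdge (y ∷ zs ++ [ x ]) u v ∨ sameEdge x y u v
    ≡⟨ ∨≡⊕ (walkEdge (y ∷ zs ++ [ x ]) u v) (sameEdge x y u v) (λ e xy → cut-avoids-cutEdge cyc xy e) ⟩
  walkEdge (y ∷ zs ++ [ x ]) u v ⊕ sameEdge x y u v
    ≡⟨ cong (_⊕ sameEdge x y u v) (walkEdge≡walkEdge⊕ (cut-unique uq) u v) ⟩
  walkEdge⊕ (y ∷ zs ++ [ x ]) u v ⊕ sameEdge x y u v
    ∎

cuts⊕cutEnds : ∀ (s : Fin n) cs → VertexDisjointCycles cs → ∀ u v →
               walkEdge⊕ (s ∷ concatMap cut cs) u v ⊕ walkEdge⊕ (s ∷ concatMap cutEnds cs) u v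
               ≡ cyclesEdge cs u v
cuts⊕cutEnds s [] _ u v = refl
cuts⊕cutEnds s ([] ∷ cs)       ((_ , ()) ∷ _ , _)
cuts⊕cutEnds s ((_ ∷ []) ∷ cs) ((_ , s≤s ()) ∷ _ , _)
cuts⊕cutEnds s ((x ∷ y ∷ zs) ∷ cs) (cyc ∷ cycs , uq) u v = begin
  (S ⊕ walkEdge⊕ (y ∷ (zs ++ [ x ]) ++ R) u v) ⊕ (S ⊕ (sameEdge y x u v ⊕ Y))
    ≡⟨ cong (λ w → (S ⊕ w) ⊕ (S ⊕ (sameEdge y x u v ⊕ Y))) split ⟩
  (S ⊕ (W ⊕ X)) ⊕ (S ⊕ (sameEdge y x u v ⊕ Y))
    ≡⟨ ⊕-cancel-common S W X (sameEdge y x u v) Y ⟩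
  (W ⊕ sameEdge y x u v) ⊕ (X ⊕ Y)
    ≡⟨ cong₂ _⊕_ (trans (cong (W ⊕_) (sameEdge-comm y x u v)) (sym (cycleEdge-cut cyc u v)))
                 (cuts⊕cutEnds x cs (cycs , Unique-++ʳ (x ∷ y ∷ zs) uq) u v) ⟩
  cycleEdge (x ∷ y ∷ zs) u v ⊕ cyclesEdge cs u v
    ≡⟨ ∨≡⊕ _ _ (cycleEdge-disjoint (x ∷ y ∷ zs) cs u v uq) ⟨
  cyclesEdge ((x ∷ y ∷ zs) ∷ cs) u v
    ∎
  where
  R = concatMap cut cs
  S = sameEdge s y u v
  W = walkEdge⊕ (y ∷ zs ++ [ x ]) u v
  X = walkEdge⊕ (x ∷ R) u v
  Y = walkEdge⊕ (x ∷ concatMap cutEnds cs) u v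
  split : walkEdge⊕ (y ∷ (zs ++ [ x ]) ++ R) u v ≡ W ⊕ X
  split = trans (cong (λ l → walkEdge⊕ (y ∷ l) u v) (++-assoc zs [ x ] R))
                (walkEdge⊕-++ (y ∷ zs) x R u v)

OddCoveredBy2Paths : (Fin n → Fin n → Bool) → Set
OddCoveredBy2Paths {n} F = ∃₂ λ (P₁ P₂ : List (Fin n)) → IsPath P₁ × IsPath P₂ ×
  (∀ u v → (pathEdge P₁ u v xor pathEdge P₂ u v) ≡ F u v)

OddCoveredBy2Paths-resp : ∀ {F G : Fin n → Fin n → Bool} → (∀ u v → F u v ≡ G u v) →
                          OddCoveredBy2Paths F → OddCoveredBy2Paths G
OddCoveredBy2Paths-resp F≗G (P₁ , P₂ , p₁ , p₂ , cover) =
  P₁ , P₂ , p₁ , p₂ , λ u v → trans (cover u v) (F≗G u v)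

cuts⊕cutEnds-minus-first-edge : ∀ (x y : Fin n) zs cs → VertexDisjointCycles ((x ∷ y ∷ zs) ∷ cs) →
  ∀ u v → walkEdge⊕ (y ∷ zs ++ x ∷ concatMap cut cs) u v ⊕ walkEdge⊕ (x ∷ concatMap cutEnds cs) u v
          ≡ cyclesEdge ((x ∷ y ∷ zs) ∷ cs) u v ∧ not (sameEdge x y u v)
cuts⊕cutEnds-minus-first-edge x y zs cs (cyc ∷ cycs , uq) u v = begin
  walkEdge⊕ ((y ∷ zs) ++ x ∷ R) u v ⊕ Y
    ≡⟨ cong (_⊕ Y) (walkEdge⊕-++ (y ∷ zs) x R u v) ⟩
  (W ⊕ X) ⊕ Y
    ≡⟨ xor-assoc W X Y ⟩
  W ⊕ (X ⊕ Y)
    ≡⟨ cong (W ⊕_) (cuts⊕cutEnds x cs (cycs , Unique-++ʳ (x ∷ y ∷ zs) uq) u v) ⟩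
  W ⊕ cyclesEdge cs u v
    ≡⟨ ⊕-∧-not W F (cyclesEdge cs u v) F-avoids-W F-avoids-cs ⟨
  ((W ⊕ F) ⊕ cyclesEdge cs u v) ∧ not F
    ≡⟨ cong (λ c → (c ⊕ cyclesEdge cs u v) ∧ not F) (cycleEdge-cut cyc u v) ⟨
  (cycleEdge (x ∷ y ∷ zs) u v ⊕ cyclesEdge cs u v) ∧ not F
    ≡⟨ cong (_∧ not F) (∨≡⊕ _ _ (cycleEdge-disjoint (x ∷ y ∷ zs) cs u v uq)) ⟨
  cyclesEdge ((x ∷ y ∷ zs) ∷ cs) u v ∧ not F
    ∎
  where
  R = concatMap cut cs
  W = walkEdge⊕ (y ∷ zs ++ [ x ]) u v
  X = walkEdge⊕ (x ∷ R) u v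
  Y = walkEdge⊕ (x ∷ concatMap cutEnds cs) u v
  F = sameEdge x y u v
  F-avoids-W : F ≡ true → W ≡ true → ⊥
  F-avoids-W f w = cut-avoids-cutEdge cyc f (trans (walkEdge≡walkEdge⊕ (cut-unique (proj₁ cyc)) u v) w)
  F-avoids-cs : F ≡ true → cyclesEdge cs u v ≡ true → ⊥
  F-avoids-cs f = cycleEdge-disjoint (x ∷ y ∷ zs) cs u v uq (cong (_∨ walkEdge (y ∷ zs ++ [ x ]) u v) f)

cycles-minus-first-edge : ∀ (x y : Fin n) zs cs → VertexDisjointCycles ((x ∷ y ∷ zs) ∷ cs) →
  OddCoveredBy2Paths (λ u v → cyclesEdge ((x ∷ y ∷ zs) ∷ cs) u v ∧ not (sameEdge x y u v))
cycles-minus-first-edge x y zs cs vdc@(_ , uq) =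
  P₁ , P₂ , (uq₁ , s≤s z≤n) , (uq₂ , s≤s z≤n) , λ u v →
    trans (xor≡⊕ (walkEdge P₁ u v) (walkEdge P₂ u v))
      (trans (cong₂ _⊕_ (walkEdge≡walkEdge⊕ uq₁ u v) (walkEdge≡walkEdge⊕ uq₂ u v))
        (cuts⊕cutEnds-minus-first-edge x y zs cs vdc u v))
  where
  R = concatMap cut cs
  P₁ = y ∷ zs ++ x ∷ R
  P₂ = x ∷ concatMap cutEnds cs
  uq₁ : Unique P₁
  uq₁ = Unique-resp-↭ (↭-sym (↭-trans (↭.shift x (y ∷ zs) R)
                               (↭-prep x (↭.++⁺ˡ (y ∷ zs) (concatMap-cut-↭ cs))))) uq
  uq₂ : Unique P₂
  uq₂ = Unique-resp-⊇ (⊆.++⁺ˡ (y ∷ zs) (refl ∷ concatMap-cutEnds⊆cut cs)) uq₁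

lemma3p5 : (n : ℕ) (cs : List (List (Fin n))) → VertexDisjointCycles cs →
    (a b : Fin n) → cyclesEdge cs a b ≡ true →
    ∃₂ λ (P₁ P₂ : List (Fin n)) → IsPath P₁ × IsPath P₂ ×
      (∀ (u v : Fin n) → (pathEdge P₁ u v xor pathEdge P₂ u v)
                          ≡ (cyclesEdge cs u v ∧ not (sameEdge a b u v)))
lemma3p5 n cs vdc a b ab with any⇒↭∷ (λ c → cycleEdge c a b) cs ab
... | c , others , cs↭ , cab with VertexDisjointCycles-resp-↭ cs↭ vdc
...   | vdc′@(c-cycle ∷ _ , _) with rotateToEdge c-cycle cab
...     | x , y , zs , c′↭c , c′≗c , xy≡ab =
  OddCoveredBy2Paths-resp same-edges
    (cycles-minus-first-edge x y zs others (VertexDisjointCycles-head-↭ (↭-sym c′↭c) vdc′))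
  where
  same-edges : ∀ u v → cyclesEdge ((x ∷ y ∷ zs) ∷ others) u v ∧ not (sameEdge x y u v)
                       ≡ cyclesEdge cs u v ∧ not (sameEdge a b u v)
  same-edges u v = cong₂ (λ p q → p ∧ not q)
    (trans (cong (_∨ _) (c′≗c u v)) (any-resp-↭ _ (↭-sym cs↭)))
    (sym (sameEdge-subst {p = x} {y} {a} {b} xy≡ab u v))
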